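{- Every ring $R$ satisfies $\chi(R)\le\lfloor\frac{3}{2}\omega(R)\rfloor$. In particular, every hyperhole $H$ satisfies $\chi(H)\le\lfloor\frac{3}{2}\omega(H)\rfloor$.
   Context: A ring is a graph $R$ whose vertex set can be partitioned into $k\ge4$ nonempty sets $X_1,\dots,X_k$ (indices in $\mathbb{Z}_k$) such that each $X_i$ can be ordered $u^i_1,\dots,u^i_{|X_i|}$ with $X_i\subseteq N_R[u^i_{|X_i|}]\subseteq\dots\subseteq N_R[u^i_1]=X_{i-1}\cup X_i\cup X_{i+1}$. A hyperhole is a graph obtained from a hole (induced cycle of length $k\ge4$) by replacing each vertex by a nonempty clique, cliques for adjacent vertices being complete to each other and otherwise anticomplete. $\chi,\omega$ denote chromatic and clique number. -}

module Defs where

open import Data.Nat using (ℕ; zero; suc; _≤_)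
open import Data.Fin using (Fin; toℕ) renaming (zero to fzero; _≤_ to _≤ᶠ_)
open import Data.Product using (Σ; _×_; _,_; proj₁; proj₂)
open import Data.Sum using (_⊎_)
open import Relation.Nullary using (¬_; Dec)
open import Relation.Binary.PropositionalEquality using (_≡_; _≢_)
open import Function.Bundles using (_↔_; Inverse)

record Graph (n : ℕ) : Set₁ where
  field
    Adj    : Fin n → Fin n → Set
    sym    : ∀ {u v} → Adj u v → Adj v u
    irrefl : ∀ {u} → ¬ Adj u u
    dec    : ∀ u v → Dec (Adj u v)
open Graph public

N[_]∋_ : ∀ {n} (G : Graph n) → Fin n → Fin n → Set
(N[ G ]∋ v) u = (u ≡ v) ⊎ Adj G v u

HasClique : ∀ {n} → Graph n → ℕ → Set
HasClique {n} G w =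
  Σ (Fin w → Fin n) λ f → ∀ a b → a ≢ b → (f a ≢ f b) × Adj G (f a) (f b)

IsCliqueNumber : ∀ {n} → Graph n → ℕ → Set
IsCliqueNumber G w = HasClique G w × (∀ w′ → HasClique G w′ → w′ ≤ w)

Colourable : ∀ {n} → Graph n → ℕ → Set
Colourable {n} G m =
  Σ (Fin n → Fin m) λ c → ∀ u v → Adj G u v → c u ≢ c v

CycSucc : ∀ {k} → Fin k → Fin k → Set
CycSucc {k} i j = (suc (toℕ i) ≡ toℕ j) ⊎ ((suc (toℕ i) ≡ k) × (toℕ j ≡ 0))

CycNear : ∀ {k} → Fin k → Fin k → Set
CycNear i j = (j ≡ i) ⊎ CycSucc i j ⊎ CycSucc j i

-- Ring structure on G: k ≥ 4 nonempty parts X_i of sizes suc (t i);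
-- the bijection `lab` identifies vertex u^i_{a+1} with lab⁻¹ (i , a).
record RingStructure {n : ℕ} (G : Graph n) : Set₁ where
  field
    k     : ℕ
    k≥4   : 4 ≤ k
    t     : Fin k → ℕ
    lab   : Fin n ↔ Σ (Fin k) (λ i → Fin (suc (t i)))
  vtx : (i : Fin k) → Fin (suc (t i)) → Fin n
  vtx i a = Inverse.from lab (i , a)
  part : Fin n → Fin k
  part v = proj₁ (Inverse.to lab v)
  field
    clique  : ∀ i a b → (N[ G ]∋ vtx i a) (vtx i b)
    nested  : ∀ i a b → a ≤ᶠ b → ∀ v → (N[ G ]∋ vtx i b) v → (N[ G ]∋ vtx i a) v
    first⊆  : ∀ i v → (N[ G ]∋ vtx i fzero) v → CycNear i (part v)
    first⊇  : ∀ i v → CycNear i (part v) → (N[ G ]∋ vtx i fzero) v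

IsRing : ∀ {n} → Graph n → Set₁
IsRing G = RingStructure G

record HyperholeStructure {n : ℕ} (G : Graph n) : Set₁ where
  field
    k     : ℕ
    k≥4   : 4 ≤ k
    part  : Fin n → Fin k
    nonempty : ∀ i → Σ (Fin n) λ v → part v ≡ i
    adj⇒  : ∀ u v → Adj G u v → (part u ≡ part v) ⊎ CycSucc (part u) (part v) ⊎ CycSucc (part v) (part u)
    ⇒adj  : ∀ u v → u ≢ v → (part u ≡ part v) ⊎ CycSucc (part u) (part v) ⊎ CycSucc (part v) (part u) → Adj G u v

IsHyperhole : ∀ {n} → Graph n → Set₁
IsHyperhole G = HyperholeStructure G

-- Number the vertices of each part X_i from 0 along the ordering of the ring.
-- If the a-th vertex of X_i and the b-th vertex of X_j (i ≠ j) are adjacent,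
-- the nesting of neighbourhoods makes the first a+1 vertices of X_i and the
-- first b+1 vertices of X_j one clique, so (a+1) + (b+1) ≤ ω; as every vertex
-- has a neighbour in the next part, also a+2 ≤ ω. With h = ⌊ω/2⌋, colour the
-- a-th vertex of X_0 by h+a, of the odd-numbered parts by ω+h−1−a, and of the
-- remaining parts by a if a < h and by ω+h−1−a otherwise. The bound
-- (a+1) + (b+1) ≤ ω separates the colours across consecutive parts, so these
-- ω + h = ⌊3ω/2⌋ colours form a proper colouring. A hyperhole is handled by
-- the same scheme, numbering each part arbitrarily.
module Submission where

open import Defs renaming (sym to Adj-sym)
open import Data.Nat
open import Data.Nat.Properties
open import Data.Nat.DivMod using (m≡m%n+[m/n]*n; m%n<n; m*n/n≡m; +-distrib-/-∣ˡ)
open import Data.Nat.Divisibility using (divides-refl)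
open import Data.Nat.Tactic.RingSolver using (solve-∀)
open import Data.Empty using (⊥-elim)
open import Data.Fin as Fin using (Fin; toℕ; fromℕ<; inject≤; splitAt; join)
  renaming (zero to fzero)
open import Data.Fin.Properties using (toℕ-fromℕ<; toℕ-injective; join-splitAt; toℕ<n; toℕ-inject≤)
  renaming (_≟_ to _≟ᶠ_)
open import Data.Product using (Σ; ∃; _×_; _,_; proj₁; proj₂)
open import Data.Sum using (_⊎_; inj₁; inj₂; [_,_]′)
import Data.Sum as Sum
open import Data.Vec.Functional using (_++_)
open import Data.List using (List; _∷_; filter; allFin; lookup)
open import Data.List.Membership.Propositional using (_∈_)
open import Data.List.Membership.Propositional.Properties using (∈-filter⁺; ∈-filter⁻; ∈-allFin; ∈-lookup)
open import Data.List.Membership.Setoid.Properties using (index-injective)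
import Data.List.Relation.Unary.Any as Any
import Data.List.Relation.Unary.All as All
import Data.List.Relation.Unary.AllPairs as AllPairs
open import Data.List.Relation.Unary.Unique.Propositional using (Unique)
open import Data.List.Relation.Unary.Unique.Propositional.Properties using (filter⁺; allFin⁺)
open import Function using (_∘_)
open import Function.Bundles using (Inverse)
open import Relation.Nullary using (yes; no)
open import Relation.Binary.PropositionalEquality

3w/2≡w+w/2 : ∀ w → (3 * w) / 2 ≡ w + w / 2
3w/2≡w+w/2 w = begin
  (3 * w) / 2         ≡⟨ cong (_/ 2) (3m≡m*2+m w) ⟩
  (w * 2 + w) / 2     ≡⟨ +-distrib-/-∣ˡ {w * 2} w (divides-refl w) ⟩
  w * 2 / 2 + w / 2   ≡⟨ cong (_+ w / 2) (m*n/n≡m w 2) ⟩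
  w + w / 2           ∎
  where
  open ≡-Reasoning
  3m≡m*2+m : ∀ m → 3 * m ≡ m * 2 + m
  3m≡m*2+m = solve-∀

w≤1+2[w/2] : ∀ w → w ≤ suc (w / 2 + w / 2)
w≤1+2[w/2] w = begin
  w                      ≡⟨ m≡m%n+[m/n]*n w 2 ⟩
  w % 2 + w / 2 * 2      ≤⟨ +-monoˡ-≤ (w / 2 * 2) (s≤s⁻¹ (m%n<n w 2)) ⟩
  1 + w / 2 * 2          ≡⟨ cong suc (m*2≡m+m (w / 2)) ⟩
  suc (w / 2 + w / 2)    ∎
  where
  open ≤-Reasoning
  m*2≡m+m : ∀ m → m * 2 ≡ m + m
  m*2≡m+m = solve-∀

module Palette (w h : ℕ) (w≤1+2h : w ≤ suc (h + h)) where

  -- The bound satisfied by the positions a, b of adjacent vertices in distinct parts.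
  Fits : ℕ → ℕ → Set
  Fits a b = suc a + suc b ≤ w

  Fits-sym : ∀ {a b} → Fits a b → Fits b a
  Fits-sym {a} {b} = subst (_≤ w) (+-comm (suc a) (suc b))

  Fits⇒valid : ∀ {a b} → Fits a b → suc (suc a) ≤ w
  Fits⇒valid {a} fits = ≤-trans (m<m+n (suc a) (s≤s z≤n)) fits

  high : ℕ → ℕ
  high a = h + a

  descending : ℕ → ℕ
  descending a = (w + h) ∸ suc a

  low : ℕ → ℕ
  low a with a <? h
  ... | yes _ = a
  ... | no  _ = descending a

  alternating : ℕ → ℕ → ℕ
  alternating zero          = descending
  alternating (suc zero)    = low
  alternating (suc (suc i)) = alternating i

  colour : ℕ → ℕ → ℕ
  colour zero    = high
  colour (suc i) = alternating i

  private
    1+a≤w+h : ∀ {a} → suc (suc a) ≤ w → suc a ≤ w + h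
    1+a≤w+h p = ≤-trans (n≤1+n _) (≤-trans p (m≤m+n _ h))

  high<descending : ∀ {a b} → Fits a b → high a < descending b
  high<descending {a} {b} fits = m+n≤o⇒m≤o∸n (suc (h + a)) (begin
    suc (h + a) + suc b   ≡⟨ regroup h a b ⟩
    h + (suc a + suc b)   ≤⟨ +-monoʳ-≤ h fits ⟩
    h + w                 ≡⟨ +-comm h w ⟩
    w + h                 ∎)
    where
    open ≤-Reasoning
    regroup : ∀ x y z → suc (x + y) + suc z ≡ x + (suc y + suc z)
    regroup = solve-∀

  h≤descending : ∀ {a} → suc (suc a) ≤ w → h ≤ descending a
  h≤descending valid = ≤-trans (m≤m+n h 0) (<⇒≤ (high<descending valid))

  descending-injective : ∀ {a b} → suc (suc a) ≤ w → suc (suc b) ≤ w →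
                         descending a ≡ descending b → a ≡ b
  descending-injective pa pb = suc-injective ∘ ∸-cancelˡ-≡ (1+a≤w+h pa) (1+a≤w+h pb)

  -- Two positions ≥ h cannot fit together since w ≤ 2h+1.
  descending≢descending : ∀ {a b} → h ≤ b → Fits a b → descending a ≢ descending b
  descending≢descending {a} {b} h≤b fits eq = <⇒≱ 2b+2>w (subst (λ x → suc x + suc b ≤ w) a≡b fits)
    where
    a≡b : a ≡ b
    a≡b = descending-injective (Fits⇒valid fits) (Fits⇒valid (Fits-sym fits)) eq
    2b+2>w : w < suc b + suc b
    2b+2>w = ≤-trans (s≤s (≤-trans w≤1+2h (s≤s (+-mono-≤ h≤b h≤b)))) (≤-reflexive (sym (+-suc (suc b) b)))

  descending≢low : ∀ {a b} → Fits a b → descending a ≢ low b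
  descending≢low {a} {b} fits with b <? h
  ... | yes _ = >⇒≢ (≤-trans (s≤s (m≤n+m b h)) (high<descending (Fits-sym fits)))
  ... | no b≮h = descending≢descending (≮⇒≥ b≮h) fits

  descending≢high : ∀ {a b} → Fits a b → descending a ≢ high b
  descending≢high fits = >⇒≢ (high<descending (Fits-sym fits))

  low≢high : ∀ {a b} → Fits a b → low a ≢ high b
  low≢high {a} {b} fits with a <? h
  ... | yes a<h = <⇒≢ (≤-trans a<h (m≤m+n h b))
  ... | no _ = descending≢high fits

  low-injective : ∀ {a b} → suc (suc a) ≤ w → suc (suc b) ≤ w → low a ≡ low b → a ≡ b
  low-injective {a} {b} pa pb eq with a <? h | b <? h
  ... | yes _   | yes _   = eq
  ... | no _    | no _    = descending-injective pa pb eq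
  ... | yes a<h | no _    = ⊥-elim (<⇒≢ (≤-trans a<h (h≤descending pb)) eq)
  ... | no _    | yes b<h = ⊥-elim (<⇒≢ (≤-trans b<h (h≤descending pa)) (sym eq))

  alternating-step : ∀ i {a b} → Fits a b → alternating i a ≢ alternating (suc i) b
  alternating-step zero                = descending≢low
  alternating-step (suc zero) fits     = ≢-sym (descending≢low (Fits-sym fits))
  alternating-step (suc (suc i))       = alternating-step i

  alternating-wrap : ∀ i {a b} → Fits a b → alternating i a ≢ high b
  alternating-wrap zero          = descending≢high
  alternating-wrap (suc zero)    = low≢high
  alternating-wrap (suc (suc i)) = alternating-wrap i

  high≢descending : ∀ {a b} → Fits a b → high a ≢ descending b
  high≢descending fits = <⇒≢ (high<descending fits)

  -- Part y follows part x cyclically; x ≢ y excludes a cycle of length one.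
  colour-cyclic-step : ∀ {x y a b} → x ≢ y → (suc x ≡ y) ⊎ (y ≡ 0) → Fits a b → colour x a ≢ colour y b
  colour-cyclic-step {zero}  _   (inj₁ refl) = high≢descending
  colour-cyclic-step {suc x} _   (inj₁ refl) = alternating-step x
  colour-cyclic-step {zero}  x≢y (inj₂ refl) = ⊥-elim (x≢y refl)
  colour-cyclic-step {suc x} _   (inj₂ refl) = alternating-wrap x

  colour-injective : ∀ i {a b} → suc (suc a) ≤ w → suc (suc b) ≤ w → colour i a ≡ colour i b → a ≡ b
  colour-injective zero                _  _  = +-cancelˡ-≡ h _ _
  colour-injective (suc zero)          pa pb = descending-injective pa pb
  colour-injective (suc (suc zero))    pa pb = low-injective pa pb
  colour-injective (suc (suc (suc i))) pa pb = colour-injective (suc i) pa pb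

  descending<w+h : ∀ {a} → suc (suc a) ≤ w → descending a < w + h
  descending<w+h p = ∸-monoʳ-< (s≤s z≤n) (1+a≤w+h p)

  colour<w+h : ∀ i {a} → suc (suc a) ≤ w → colour i a < w + h
  colour<w+h zero {a} p = subst (h + a <_) (+-comm h w) (+-monoʳ-< h (≤-trans (n≤1+n _) p))
  colour<w+h (suc zero) p = descending<w+h p
  colour<w+h (suc (suc zero)) {a} p with a <? h
  ... | yes a<h = ≤-trans a<h (m≤n+m h w)
  ... | no _    = descending<w+h p
  colour<w+h (suc (suc (suc i))) p = colour<w+h (suc i) p

-- What the colouring needs from a ring or a hyperhole: positions within the
-- cyclically arranged parts, bounded across edges by the clique number.
record CyclicLayering {n : ℕ} (G : Graph n) (w : ℕ) : Set where
  field
    k                  : ℕ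
    part               : Fin n → Fin k
    position           : Fin n → ℕ
    adj⇒near           : ∀ {u v} → Adj G u v → CycNear (part u) (part v)
    position-injective : ∀ {u v} → part u ≡ part v → position u ≡ position v → u ≡ v
    cross-fits         : ∀ {u v} → part u ≢ part v → Adj G u v → suc (position u) + suc (position v) ≤ w
    foreign-neighbour  : ∀ u → ∃ λ v → part u ≢ part v × Adj G u v

module _ {n w} {G : Graph n} (L : CyclicLayering G w) where
  open CyclicLayering L
  open Palette w (w / 2) (w≤1+2[w/2] w)

  position-fits : ∀ u → suc (suc (position u)) ≤ w
  position-fits u with foreign-neighbour u
  ... | v , pu≢pv , uv = Fits⇒valid (cross-fits pu≢pv uv)

  colourOf : Fin n → ℕ
  colourOf u = colour (toℕ (part u)) (position u)

  colour-CycSucc : ∀ {i j : Fin k} {a b} → i ≢ j → CycSucc i j → Fits a b →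
                   colour (toℕ i) a ≢ colour (toℕ j) b
  colour-CycSucc i≢j cs = colour-cyclic-step (i≢j ∘ toℕ-injective) (Sum.map₂ proj₂ cs)

  colourOf-proper : ∀ {u v} → Adj G u v → colourOf u ≢ colourOf v
  colourOf-proper {u} {v} uv same with part u ≟ᶠ part v
  ... | yes pu≡pv = irrefl G (subst (Adj G u) (sym u≡v) uv)
    where
    u≡v : u ≡ v
    u≡v = position-injective pu≡pv (colour-injective (toℕ (part u)) (position-fits u) (position-fits v)
            (subst (λ p → colourOf u ≡ colour (toℕ p) (position v)) (sym pu≡pv) same))
  ... | no pu≢pv with adj⇒near uv
  ...   | inj₁ pv≡pu       = pu≢pv (sym pv≡pu)
  ...   | inj₂ (inj₁ u→v) = colour-CycSucc pu≢pv u→v (cross-fits pu≢pv uv) same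
  ...   | inj₂ (inj₂ v→u) = colour-CycSucc (≢-sym pu≢pv) v→u (cross-fits (≢-sym pu≢pv) (Adj-sym G uv)) (sym same)

  layered⇒colourable : Colourable G (w + w / 2)
  layered⇒colourable = (λ u → fromℕ< (colour<w+h (toℕ (part u)) (position-fits u)))
                     , λ u v uv eq → colourOf-proper uv
                         (trans (sym (toℕ-fromℕ< _)) (trans (cong toℕ eq) (toℕ-fromℕ< _)))

CycSucc-irrefl : ∀ {k} → 2 ≤ k → {i j : Fin k} → CycSucc i j → i ≢ j
CycSucc-irrefl _   (inj₁ e) refl = 1+n≢n e
CycSucc-irrefl 2≤k (inj₂ (e , j≡0)) refl = <⇒≢ (s≤s⁻¹ (subst (2 ≤_) (sym e) 2≤k)) (sym j≡0)

cyclic-successor : ∀ {k} (i : Fin k) → Σ (Fin k) (CycSucc i)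
cyclic-successor {suc k} i with suc (toℕ i) <? suc k
... | yes 1+i<1+k = fromℕ< 1+i<1+k , inj₁ (sym (toℕ-fromℕ< 1+i<1+k))
... | no  1+i≮1+k = fzero , inj₂ (≤-antisym (toℕ<n i) (≮⇒≥ 1+i≮1+k) , refl)

splitAt-injective : ∀ m {n} {i j : Fin (m + n)} → splitAt m i ≡ splitAt m j → i ≡ j
splitAt-injective m {n} {i} {j} eq = begin
  i                      ≡⟨ join-splitAt m n i ⟨
  join m n (splitAt m i) ≡⟨ cong (join m n) eq ⟩
  join m n (splitAt m j) ≡⟨ join-splitAt m n j ⟩
  j                      ∎
  where open ≡-Reasoning

Unique-lookup-injective : ∀ {A : Set} (xs : List A) → Unique xs → ∀ i j → lookup xs i ≡ lookup xs j → i ≡ j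
Unique-lookup-injective (x ∷ xs) _ fzero fzero _ = refl
Unique-lookup-injective (x ∷ xs) (x∉xs AllPairs.∷ _) fzero (Fin.suc j) eq =
  ⊥-elim (All.lookup x∉xs (∈-lookup j) eq)
Unique-lookup-injective (x ∷ xs) (x∉xs AllPairs.∷ _) (Fin.suc i) fzero eq =
  ⊥-elim (All.lookup x∉xs (∈-lookup i) (sym eq))
Unique-lookup-injective (x ∷ xs) (_ AllPairs.∷ uniq) (Fin.suc i) (Fin.suc j) eq =
  cong Fin.suc (Unique-lookup-injective xs uniq i j eq)

module _ {n} (G : Graph n) where

  PairwiseAdjacent : ∀ {I : Set} → (I → Fin n) → Set
  PairwiseAdjacent f = ∀ a b → a ≢ b → Adj G (f a) (f b)

  PairwiseAdjacent⇒HasClique : ∀ {m} {f : Fin m → Fin n} → PairwiseAdjacent f → HasClique G m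
  PairwiseAdjacent⇒HasClique {f = f} adj = f , λ a b a≢b →
    (λ fa≡fb → irrefl G (subst (Adj G (f a)) (sym fa≡fb) (adj a b a≢b))) , adj a b a≢b

  PairwiseAdjacent-++ : ∀ {m₁ m₂} {A : Fin m₁ → Fin n} {B : Fin m₂ → Fin n} →
    PairwiseAdjacent A → PairwiseAdjacent B → (∀ x y → Adj G (A x) (B y)) → PairwiseAdjacent (A ++ B)
  PairwiseAdjacent-++ {m₁} {A = A} {B} adjA adjB adjAB z z′ z≢z′ =
    on-sum (splitAt m₁ z) (splitAt m₁ z′) (z≢z′ ∘ splitAt-injective m₁)
    where
    on-sum : PairwiseAdjacent [ A , B ]′
    on-sum (inj₁ x) (inj₁ y) ne = adjA x y (ne ∘ cong inj₁)
    on-sum (inj₁ x) (inj₂ y) _  = adjAB x y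
    on-sum (inj₂ x) (inj₁ y) _  = Adj-sym G (adjAB y x)
    on-sum (inj₂ x) (inj₂ y) ne = adjB x y (ne ∘ cong inj₂)

  complete-cliques-fit : ∀ {w m₁ m₂} {A : Fin m₁ → Fin n} {B : Fin m₂ → Fin n} → IsCliqueNumber G w →
    PairwiseAdjacent A → PairwiseAdjacent B → (∀ x y → Adj G (A x) (B y)) → m₁ + m₂ ≤ w
  complete-cliques-fit ω adjA adjB adjAB =
    proj₂ ω _ (PairwiseAdjacent⇒HasClique (PairwiseAdjacent-++ adjA adjB adjAB))

module _ {n} {G : Graph n} (RS : RingStructure G) {w} (ω : IsCliqueNumber G w) where
  open RingStructure RS

  label : (u : Fin n) → Fin (suc (t (part u)))
  label u = proj₂ (Inverse.to lab u)

  vtx-label : ∀ u → vtx (part u) (label u) ≡ u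
  vtx-label = Inverse.strictlyInverseʳ lab

  vtx-part : ∀ i a → part (vtx i a) ≡ i
  vtx-part i a = cong proj₁ (Inverse.strictlyInverseˡ lab (i , a))

  vtx-injectiveˡ : ∀ {i j a b} → vtx i a ≡ vtx j b → i ≡ j
  vtx-injectiveˡ {i} {j} {a} {b} e = trans (sym (vtx-part i a)) (trans (cong part e) (vtx-part j b))

  vtx-injectiveʳ : ∀ {i a b} → vtx i a ≡ vtx i b → toℕ a ≡ toℕ b
  vtx-injectiveʳ {i} {a} {b} e = cong (toℕ ∘ proj₂)
    (trans (sym (Inverse.strictlyInverseˡ lab (i , a))) (trans (cong (Inverse.to lab) e) (Inverse.strictlyInverseˡ lab (i , b))))

  prefix : ∀ i (a : Fin (suc (t i))) → Fin (suc (toℕ a)) → Fin n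
  prefix i a x = vtx i (inject≤ x (toℕ<n a))

  prefix≤ : ∀ i (a : Fin (suc (t i))) x → toℕ (inject≤ x (toℕ<n a)) ≤ toℕ a
  prefix≤ i a x = subst (_≤ toℕ a) (sym (toℕ-inject≤ x (toℕ<n a))) (s≤s⁻¹ (toℕ<n x))

  prefix-adjacent : ∀ i a → PairwiseAdjacent G (prefix i a)
  prefix-adjacent i a x y x≢y with clique i (inject≤ x (toℕ<n a)) (inject≤ y (toℕ<n a))
  ... | inj₂ adj = adj
  ... | inj₁ e = ⊥-elim (x≢y (toℕ-injective (begin
    toℕ x                        ≡⟨ toℕ-inject≤ x (toℕ<n a) ⟨
    toℕ (inject≤ x (toℕ<n a))    ≡⟨ vtx-injectiveʳ e ⟨
    toℕ (inject≤ y (toℕ<n a))    ≡⟨ toℕ-inject≤ y (toℕ<n a) ⟩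
    toℕ y                        ∎)))
    where open ≡-Reasoning

  -- Shrinking neighbourhoods along each part push an edge between
  -- u^i_{a+1} and u^j_{b+1} down to all earlier vertices of both parts.
  prefixes-complete : ∀ {i j} a b → i ≢ j → Adj G (vtx i a) (vtx j b) →
                      ∀ x y → Adj G (prefix i a x) (prefix j b y)
  prefixes-complete {i} {j} a b i≢j adj x y
    with nested i (inject≤ x (toℕ<n a)) a (prefix≤ i a x) (vtx j b) (inj₂ adj)
  ... | inj₁ e = ⊥-elim (i≢j (sym (vtx-injectiveˡ e)))
  ... | inj₂ adj′ with nested j (inject≤ y (toℕ<n b)) b (prefix≤ j b y) (prefix i a x) (inj₂ (Adj-sym G adj′))
  ...   | inj₁ e = ⊥-elim (i≢j (vtx-injectiveˡ e))
  ...   | inj₂ adj″ = Adj-sym G adj″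

  ringLayering : CyclicLayering G w
  ringLayering = record
    { k                  = k
    ; part               = part
    ; position           = toℕ ∘ label
    ; adj⇒near           = adj⇒near
    ; position-injective = position-injective
    ; cross-fits         = cross-fits
    ; foreign-neighbour  = foreign-neighbour
    }
    where
    2≤k : 2 ≤ k
    2≤k = ≤-trans (s≤s (s≤s z≤n)) k≥4

    adj⇒near : ∀ {u v} → Adj G u v → CycNear (part u) (part v)
    adj⇒near {u} {v} uv = first⊆ (part u) v (nested (part u) fzero (label u) z≤n v
      (inj₂ (subst (λ z → Adj G z v) (sym (vtx-label u)) uv)))

    position-injective : ∀ {u v} → part u ≡ part v → toℕ (label u) ≡ toℕ (label v) → u ≡ v
    position-injective {u} {v} pu≡pv lu≡lv = begin
      u                                       ≡⟨ Inverse.strictlyInverseʳ lab u ⟨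
      Inverse.from lab (Inverse.to lab u)     ≡⟨ cong (Inverse.from lab) (same-label (Inverse.to lab u) (Inverse.to lab v) pu≡pv lu≡lv) ⟩
      Inverse.from lab (Inverse.to lab v)     ≡⟨ Inverse.strictlyInverseʳ lab v ⟩
      v                                       ∎
      where
      open ≡-Reasoning
      same-label : ∀ (p q : Σ (Fin k) (λ i → Fin (suc (t i)))) →
                   proj₁ p ≡ proj₁ q → toℕ (proj₂ p) ≡ toℕ (proj₂ q) → p ≡ q
      same-label (i , a) (.i , b) refl e = cong (i ,_) (toℕ-injective e)

    cross-fits : ∀ {u v} → part u ≢ part v → Adj G u v → suc (toℕ (label u)) + suc (toℕ (label v)) ≤ w
    cross-fits {u} {v} pu≢pv uv = complete-cliques-fit G ω
      (prefix-adjacent (part u) (label u)) (prefix-adjacent (part v) (label v))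
      (prefixes-complete (label u) (label v) pu≢pv (subst₂ (Adj G) (sym (vtx-label u)) (sym (vtx-label v)) uv))

    foreign-neighbour : ∀ u → ∃ λ v → part u ≢ part v × Adj G u v
    foreign-neighbour u with cyclic-successor (part u)
    ... | j , u→j with first⊇ j u (inj₂ (inj₂ u→j))
    ...   | inj₁ u≡vtx = ⊥-elim (CycSucc-irrefl 2≤k u→j (trans (cong part u≡vtx) (vtx-part j fzero)))
    ...   | inj₂ adj = vtx j fzero
                     , (λ e → CycSucc-irrefl 2≤k u→j (trans e (vtx-part j fzero)))
                     , Adj-sym G adj

module _ {n} {G : Graph n} (HS : HyperholeStructure G) {w} (ω : IsCliqueNumber G w) where
  open HyperholeStructure HS

  members : Fin k → List (Fin n)
  members i = filter (λ v → part v ≟ᶠ i) (allFin n)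

  members-unique : ∀ i → Unique (members i)
  members-unique i = filter⁺ (λ v → part v ≟ᶠ i) (allFin⁺ n)

  ∈-members : ∀ u → u ∈ members (part u)
  ∈-members u = ∈-filter⁺ (λ v → part v ≟ᶠ part u) (∈-allFin u) refl

  members-part : ∀ i x → part (lookup (members i) x) ≡ i
  members-part i x = proj₂ (∈-filter⁻ (λ v → part v ≟ᶠ i) {xs = allFin n} (∈-lookup x))

  members-adjacent : ∀ i → PairwiseAdjacent G (lookup (members i))
  members-adjacent i x y x≢y = ⇒adj _ _ (x≢y ∘ Unique-lookup-injective (members i) (members-unique i) x y)
    (inj₁ (trans (members-part i x) (sym (members-part i y))))

  members-complete : ∀ {i j} → i ≢ j → CycSucc i j ⊎ CycSucc j i →
                     ∀ x y → Adj G (lookup (members i) x) (lookup (members j) y)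
  members-complete {i} {j} i≢j cs x y = ⇒adj _ _
    (λ e → i≢j (trans (sym (members-part i x)) (trans (cong part e) (members-part j y))))
    (inj₂ (subst₂ (λ a b → CycSucc a b ⊎ CycSucc b a) (sym (members-part i x)) (sym (members-part j y)) cs))

  hyperholeLayering : CyclicLayering G w
  hyperholeLayering = record
    { k                  = k
    ; part               = part
    ; position           = position
    ; adj⇒near           = adj⇒near
    ; position-injective = λ {u} {v} → member-injective (∈-members u) (∈-members v)
    ; cross-fits         = cross-fits
    ; foreign-neighbour  = foreign-neighbour
    }
    where
    position : Fin n → ℕ
    position u = toℕ (Any.index (∈-members u))

    adj⇒near : ∀ {u v} → Adj G u v → CycNear (part u) (part v)
    adj⇒near {u} {v} uv = Sum.map₁ sym (adj⇒ u v uv)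

    member-injective : ∀ {i j u v} (p : u ∈ members i) (q : v ∈ members j) → i ≡ j →
                       toℕ (Any.index p) ≡ toℕ (Any.index q) → u ≡ v
    member-injective p q refl e = index-injective (setoid (Fin n)) p q (toℕ-injective e)

    cross-fits : ∀ {u v} → part u ≢ part v → Adj G u v → suc (position u) + suc (position v) ≤ w
    cross-fits {u} {v} pu≢pv uv with adj⇒ u v uv
    ... | inj₁ pu≡pv = ⊥-elim (pu≢pv pu≡pv)
    ... | inj₂ cs = ≤-trans (+-mono-≤ (toℕ<n (Any.index (∈-members u))) (toℕ<n (Any.index (∈-members v))))
      (complete-cliques-fit G ω (members-adjacent (part u)) (members-adjacent (part v)) (members-complete pu≢pv cs))

    foreign-neighbour : ∀ u → ∃ λ v → part u ≢ part v × Adj G u v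
    foreign-neighbour u with cyclic-successor (part u)
    ... | j , u→j with nonempty j
    ...   | v , pv≡j = v , pu≢pv , ⇒adj u v (pu≢pv ∘ cong part) (inj₂ (inj₁ (subst (CycSucc (part u)) (sym pv≡j) u→j)))
      where
      pu≢pv : part u ≢ part v
      pu≢pv e = CycSucc-irrefl (≤-trans (s≤s (s≤s z≤n)) k≥4) u→j (trans e pv≡j)

mainTheorem14 : ((n : ℕ) (R : Graph n) → IsRing R → (w : ℕ) → IsCliqueNumber R w → Colourable R ((3 * w) / 2))
    × ((n : ℕ) (H : Graph n) → IsHyperhole H → (w : ℕ) → IsCliqueNumber H w → Colourable H ((3 * w) / 2))
mainTheorem14 =
    (λ n R ring w ω → ⌊3w/2⌋-colourable R w (layered⇒colourable (ringLayering ring ω)))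
  , (λ n H hyperhole w ω → ⌊3w/2⌋-colourable H w (layered⇒colourable (hyperholeLayering hyperhole ω)))
  where
  ⌊3w/2⌋-colourable : ∀ {n} (G : Graph n) w → Colourable G (w + w / 2) → Colourable G ((3 * w) / 2)
  ⌊3w/2⌋-colourable G w = subst (Colourable G) (sym (3w/2≡w+w/2 w))
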